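{- Let $n$ be a positive integer with $\gcd(n,6)=1$ having at least three distinct prime factors, let $G$ be a cyclic group of order $n$ and $g\in G$ with $\mathrm{ord}(g)=n$. Let $x_1,\dots,x_4\in[1,n-1]$ with $\gcd(n,x_1,x_2,x_3,x_4)=1$ be such that $S=(x_1g)(x_2g)(x_3g)(x_4g)$ is a minimal zero-sum sequence over $G$. Write $f(x_i)=\gcd(n,x_i)$. If $f(x_1)=7$, $\gcd(f(x_1),f(x_i))=1$ for $i=2,3,4$, and $7^2\nmid n$, then $\mathrm{ind}(S)=1$.
   Context: $G$ is written additively; sequences over $G$ are unordered finite sequences with repetition, written multiplicatively. A minimal zero-sum sequence is one whose terms sum to $0$ and no proper nontrivial subsequence sums to $0$. For a sequence $S=(n_1h)\cdot\ldots\cdot(n_kh)$ with $h$ a generator of $G$ and $1\le n_i\le|G|$, $\|S\|_h=(n_1+\cdots+n_k)/\mathrm{ord}(h)$, and $\mathrm{ind}(S)=\min\{\|S\|_h: \langle h\rangle=G\}$. -}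

module Defs where

open import Data.Nat using (ℕ; zero; suc; _+_; _*_; _≤_; _<_; _%_; NonZero)
open import Data.Nat.GCD using (gcd)
open import Data.Nat.Divisibility using (_∣_)
open import Data.Nat.Primality using (Prime)
open import Data.Fin using (Fin)
open import Data.Bool using (Bool; true; false)
open import Data.Vec using (Vec; []; _∷_)
open import Data.Product using (Σ; _×_; ∃)
open import Relation.Binary.PropositionalEquality using (_≡_; _≢_)
open import Relation.Nullary using (¬_)

-- The cyclic group G of order n is modelled as ℤ/nℤ (residues of ℕ mod n),
-- with the distinguished generator g = 1; so the element x·g is x mod n.

sumF : ∀ {k} → (Fin k → ℕ) → ℕ
sumF {zero} x = 0
sumF {suc k} x = x Fin.zero + sumF (λ i → x (Fin.suc i))
  where import Data.Fin as Fin

sumSel : ∀ {k} → Vec Bool k → (Fin k → ℕ) → ℕ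
sumSel [] x = 0
sumSel (true ∷ I) x = x Fin.zero + sumSel I (λ i → x (Fin.suc i))
  where import Data.Fin as Fin
sumSel (false ∷ I) x = sumSel I (λ i → x (Fin.suc i))
  where import Data.Fin as Fin

NonEmpty : ∀ {k} → Vec Bool k → Set
NonEmpty I = Σ _ λ (i : Fin _) → Data.Vec.lookup I i ≡ true
  where import Data.Vec

Full : ∀ {k} → Vec Bool k → Set
Full I = ∀ i → Data.Vec.lookup I i ≡ true
  where import Data.Vec

MinimalZeroSum : (n : ℕ) → .{{NonZero n}} → ∀ {k} → (Fin k → ℕ) → Set
MinimalZeroSum n {k} x =
  (sumF x % n ≡ 0) ×
  (∀ (I : Vec Bool k) → NonEmpty I → ¬ Full I → ¬ (sumSel I x % n ≡ 0))

IsGen : (n a : ℕ) → Set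
IsGen n a = (1 ≤ a) × (a ≤ n) × (gcd a n ≡ 1)

-- c gives the coefficients of S w.r.t. the generator h = a·g:
-- x_i g = c_i h with 1 ≤ c_i ≤ n.
Coeffs : (n : ℕ) → .{{NonZero n}} → (a : ℕ) → ∀ {k} → (Fin k → ℕ) → (Fin k → ℕ) → Set
Coeffs n a x c = ∀ i → (1 ≤ c i) × (c i ≤ n) × ((c i * a) % n ≡ x i % n)

-- ind(S) = 1, where ||S||_h = (Σ c_i)/n and ind(S) = min over generators h:
-- the minimum is attained with value 1, i.e. some generator gives Σ c_i = n
-- and every generator gives Σ c_i ≥ n.
IndIsOne : (n : ℕ) → .{{NonZero n}} → ∀ {k} → (Fin k → ℕ) → Set
IndIsOne n x =
  (Σ ℕ λ a → IsGen n a × Σ (Fin _ → ℕ) λ c → Coeffs n a x c × (sumF c ≡ n)) ×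
  (∀ a c → IsGen n a → Coeffs n a x c → n ≤ sumF c)

AtLeastThreePrimeFactors : ℕ → Set
AtLeastThreePrimeFactors n =
  Σ ℕ λ p → Σ ℕ λ q → Σ ℕ λ r →
    Prime p × Prime q × Prime r × (p ≢ q) × (p ≢ r) × (q ≢ r) ×
    (p ∣ n) × (q ∣ n) × (r ∣ n)

{-# OPTIONS --safe #-}
module Submission where

-- For any generator h = a·g the coefficients c_i of S satisfy (Σ c_i)·a ≡ Σ x_i ≡ 0,
-- so Σ c_i is a positive multiple of n and ‖S‖_h ≥ 1.  For the converse write n = 7m
-- and x₁ = 7y with gcd(m, y) = 1; 7 ∤ m and gcd(n, 6) = 1 force m ≥ 5.  With b an
-- inverse of y mod m, each multiplier u = t m + b (t < 7) sends x₁ to 7 and every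
-- other x_i to a residue whose low base-m digit r_i does not depend on t, while its
-- high digit W_i(t) runs through all residues mod 7 as t varies.  A coefficient sum of
-- 2n or more would force the high digits to add up to at least 11, but over the seven
-- choices of t they add up to 63, and at most one u is divisible by 7; so some unit u
-- gives coefficient sum exactly n, and u⁻¹ is the required generator.

open import Defs
open import Data.Nat using (ℕ; suc; _≤_; _∸_; _*_; NonZero)
open import Data.Nat.GCD using (gcd)
open import Data.Nat.Divisibility using (_∣_)
open import Data.Fin using (Fin; zero; suc)
open import Data.Product using (_×_)
open import Relation.Binary.PropositionalEquality using (_≡_)
open import Relation.Nullary using (¬_)

open import Data.Nat
open import Data.Nat.Properties
open import Data.Nat.DivMod
open import Data.Nat.Divisibility
open import Data.Nat.GCD
open import Data.Nat.Coprimality using (Coprime; coprime-Bézout; coprime-divisor; gcd≡1⇒coprime; coprime⇒gcd≡1)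
import Data.Nat.Coprimality as Coprime
open import Data.Nat.Primality using (Prime; prime?; euclidsLemma; prime⇒irreducible)
open import Data.Nat.Tactic.RingSolver using (solve-∀)
open import Algebra.Properties.CommutativeSemigroup +-commutativeSemigroup using (interchange)
open import Data.Fin using (toℕ)
open import Data.Fin.Properties using (all?; any?; toℕ<n; toℕ-injective; toℕ-fromℕ<)
import Data.Fin.Properties as Fin
open import Data.Product
open import Data.Sum using (_⊎_; inj₁; inj₂)
open import Function using (_∘_)
open import Relation.Nullary using (yes; no; ¬?; contradiction)
open import Relation.Nullary.Decidable using (from-yes; _×-dec_; _→-dec_)
open import Relation.Binary.PropositionalEquality

module _ (N : ℕ) .{{_ : NonZero N}} where

  %-cong-+ : ∀ {a a′ b b′} → a % N ≡ a′ % N → b % N ≡ b′ % N → (a + b) % N ≡ (a′ + b′) % N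
  %-cong-+ {a} {a′} {b} {b′} a≡a′ b≡b′ = begin
    (a + b) % N                 ≡⟨ %-distribˡ-+ a b N ⟩
    (a % N + b % N) % N         ≡⟨ cong₂ (λ p q → (p + q) % N) a≡a′ b≡b′ ⟩
    (a′ % N + b′ % N) % N       ≡⟨ %-distribˡ-+ a′ b′ N ⟨
    (a′ + b′) % N               ∎
    where open ≡-Reasoning

  %-congˡ-* : ∀ {a a′} b → a % N ≡ a′ % N → (a * b) % N ≡ (a′ * b) % N
  %-congˡ-* {a} {a′} b a≡a′ = begin
    (a * b) % N                 ≡⟨ %-distribˡ-* a b N ⟩
    (a % N * (b % N)) % N       ≡⟨ cong (λ p → (p * (b % N)) % N) a≡a′ ⟩
    (a′ % N * (b % N)) % N      ≡⟨ %-distribˡ-* a′ b N ⟨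
    (a′ * b) % N                ∎
    where open ≡-Reasoning

  %-congʳ-* : ∀ a {b b′} → b % N ≡ b′ % N → (a * b) % N ≡ (a * b′) % N
  %-congʳ-* a {b} {b′} b≡b′ = begin
    (a * b) % N    ≡⟨ cong (_% N) (*-comm a b) ⟩
    (b * a) % N    ≡⟨ %-congˡ-* a b≡b′ ⟩
    (b′ * a) % N   ≡⟨ cong (_% N) (*-comm b′ a) ⟩
    (a * b′) % N   ∎
    where open ≡-Reasoning

mod-inverse : ∀ {u} N .{{_ : NonZero N}} → Coprime u N → ∃ λ v → (u * v) % N ≡ 1 % N
mod-inverse {u} N@(suc N′) u⊥N with coprime-Bézout u⊥N
... | Bézout.+- x y eq = x , (begin
  (u * x) % N       ≡⟨ cong (_% N) (trans eq (*-comm x u)) ⟨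
  (1 + y * N) % N   ≡⟨ [m+kn]%n≡m%n 1 y N ⟩
  1 % N             ∎)
  where open ≡-Reasoning
... | Bézout.-+ x y eq = x * N′ , (begin
  (u * (x * N′)) % N                ≡⟨ [m+kn]%n≡m%n (u * (x * N′)) y N ⟨
  (u * (x * N′) + y * N) % N        ≡⟨ cong (λ z → (u * (x * N′) + z) % N) eq ⟨
  (u * (x * N′) + (1 + x * u)) % N  ≡⟨ cong (_% N) (rearrange u x N′) ⟩
  (1 + u * x * N) % N               ≡⟨ [m+kn]%n≡m%n 1 (u * x) N ⟩
  1 % N                             ∎)
  where
  open ≡-Reasoning
  -- x (N - 1) is an inverse because x u ≡ -1 (mod N).
  rearrange : ∀ u x N′ → u * (x * N′) + (1 + x * u) ≡ 1 + u * x * suc N′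
  rearrange = solve-∀

inverse⇒coprime : ∀ {u v} N .{{_ : NonZero N}} → (u * v) % N ≡ 1 % N → Coprime u N
inverse⇒coprime {v = v} N uv≡1 (d∣u , d∣N) =
  ∣1⇒≡1 (∣n∣m%n⇒∣m d∣N (subst (_ ∣_) uv≡1 (%-presˡ-∣ (∣m⇒∣m*n v d∣u) d∣N)))

coprime-*ʳ : ∀ {a b c} → Coprime a b → Coprime a c → Coprime a (b * c)
coprime-*ʳ a⊥b a⊥c (d∣a , d∣bc) =
  a⊥c (d∣a , coprime-divisor (λ (e∣d , e∣b) → a⊥b (∣-trans e∣d d∣a , e∣b)) d∣bc)

coprime-*+ : ∀ {a m} k → Coprime a m → Coprime (k * m + a) m
coprime-*+ k a⊥m (d∣a+km , d∣m) = a⊥m (∣m+n∣m⇒∣n d∣a+km (∣n⇒∣m*n k d∣m) , d∣m)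

prime∤⇒coprime : ∀ {p a} → Prime p → ¬ p ∣ a → Coprime a p
prime∤⇒coprime p-prime p∤a (d∣a , d∣p) with prime⇒irreducible p-prime d∣p
... | inj₁ d≡1 = d≡1
... | inj₂ refl = contradiction d∣a p∤a

-- Multiplying by a unit u maps x to its coefficients with respect to the generator u⁻¹.
unit⇒coefficients : ∀ N .{{_ : NonZero N}} {k} {u} → 1 < N → Coprime u N →
  (x : Fin k → ℕ) → (∀ i → ¬ N ∣ x i) →
  Σ ℕ λ a → IsGen N a × Coeffs N a x (λ i → (x i * u) % N)
unit⇒coefficients N {u = u} 1<N u⊥N x N∤x =
  a , (1≤a , m%n≤n v N , coprime⇒gcd≡1 a⊥N) , coefficient
  where
  v : ℕ
  v = proj₁ (mod-inverse N u⊥N)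
  a : ℕ
  a = v % N
  ua≡1 : (u * a) % N ≡ 1 % N
  ua≡1 = trans (%-congʳ-* N u (m%n%n≡m%n v N)) (proj₂ (mod-inverse N u⊥N))
  1≤a : 1 ≤ a
  1≤a = n≢0⇒n>0 λ a≡0 → 0≢1+n (begin
    0           ≡⟨ m*n%n≡0 u N ⟨
    u * N % N   ≡⟨ %-congʳ-* N u (trans (n%n≡0 N) (sym (trans (m%n%n≡m%n v N) a≡0))) ⟩
    u * a % N   ≡⟨ ua≡1 ⟩
    1 % N       ≡⟨ m<n⇒m%n≡m 1<N ⟩
    1           ∎)
    where open ≡-Reasoning
  a⊥N : Coprime a N
  a⊥N = inverse⇒coprime N (trans (cong (_% N) (*-comm a u)) ua≡1)
  coefficient : ∀ i → 1 ≤ (x i * u) % N × (x i * u) % N ≤ N × ((x i * u) % N * a) % N ≡ x i % N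
  coefficient i = n≢0⇒n>0 xu%N≢0 , m%n≤n (x i * u) N , (begin
    ((x i * u) % N * a) % N   ≡⟨ %-congˡ-* N a (m%n%n≡m%n (x i * u) N) ⟩
    (x i * u * a) % N         ≡⟨ cong (_% N) (*-assoc (x i) u a) ⟩
    (x i * (u * a)) % N       ≡⟨ %-congʳ-* N (x i) ua≡1 ⟩
    (x i * 1) % N             ≡⟨ cong (_% N) (*-identityʳ (x i)) ⟩
    x i % N                   ∎)
    where
    open ≡-Reasoning
    xu%N≢0 : (x i * u) % N ≢ 0
    xu%N≢0 xu≡0 = N∤x i (coprime-divisor (Coprime.sym u⊥N)
      (subst (N ∣_) (*-comm (x i) u) (m%n≡0⇒n∣m (x i * u) N xu≡0)))

sumF-cong : ∀ {k} {f g : Fin k → ℕ} → (∀ i → f i ≡ g i) → sumF f ≡ sumF g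
sumF-cong {zero} f≡g = refl
sumF-cong {suc k} f≡g = cong₂ _+_ (f≡g zero) (sumF-cong (f≡g ∘ suc))

sumF-cong-% : ∀ N .{{_ : NonZero N}} {k} {f g : Fin k → ℕ} →
  (∀ i → f i % N ≡ g i % N) → sumF f % N ≡ sumF g % N
sumF-cong-% N {zero} f≡g = refl
sumF-cong-% N {suc k} f≡g = %-cong-+ N (f≡g zero) (sumF-cong-% N (f≡g ∘ suc))

sumF-+ : ∀ {k} (f g : Fin k → ℕ) → sumF (λ i → f i + g i) ≡ sumF f + sumF g
sumF-+ {zero} f g = refl
sumF-+ {suc k} f g = trans (cong (f zero + g zero +_) (sumF-+ (f ∘ suc) (g ∘ suc)))
  (interchange (f zero) (g zero) (sumF (f ∘ suc)) (sumF (g ∘ suc)))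

sumF-*ʳ : ∀ {k} (f : Fin k → ℕ) c → sumF (λ i → f i * c) ≡ sumF f * c
sumF-*ʳ {zero} f c = refl
sumF-*ʳ {suc k} f c = trans (cong (f zero * c +_) (sumF-*ʳ (f ∘ suc) c))
  (sym (*-distribʳ-+ c (f zero) (sumF (f ∘ suc))))

sumF-zero : ∀ k → sumF {k} (λ _ → 0) ≡ 0
sumF-zero zero = refl
sumF-zero (suc k) = sumF-zero k

sumF-swap : ∀ {j k} (f : Fin j → Fin k → ℕ) →
  sumF (λ i → sumF (f i)) ≡ sumF (λ t → sumF (λ i → f i t))
sumF-swap {zero} {k} f = sym (sumF-zero k)
sumF-swap {suc j} f = trans (cong (sumF (f zero) +_) (sumF-swap (f ∘ suc)))
  (sym (sumF-+ (f zero) (λ t → sumF (λ i → f (suc i) t))))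

sumF-<-* : ∀ {k} {B} (f : Fin k → ℕ) → (∀ i → f i < B) → sumF f + k ≤ k * B
sumF-<-* {zero} f f<B = z≤n
sumF-<-* {suc k} {B} f f<B = subst (_≤ B + k * B) (shuffle (f zero) (sumF (f ∘ suc)) k)
  (+-mono-≤ (f<B zero) (sumF-<-* (f ∘ suc) (f<B ∘ suc)))
  where
  shuffle : ∀ a s k → suc a + (s + k) ≡ a + s + suc k
  shuffle = solve-∀

*-≤-sumF : ∀ {k} {B} (f : Fin k → ℕ) → (∀ i → B ≤ f i) → k * B ≤ sumF f
*-≤-sumF {zero} f B≤f = z≤n
*-≤-sumF {suc k} f B≤f = +-mono-≤ (B≤f zero) (*-≤-sumF (f ∘ suc) (B≤f ∘ suc))

*-≤-sumF-but-one : ∀ {k} {B} (f : Fin k → ℕ) (P : Fin k → Set) →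
  (∀ s t → P s → P t → s ≡ t) → (∀ i → P i ⊎ B ≤ f i) → k * B ≤ sumF f + B
*-≤-sumF-but-one {zero} f P P-unique P⊎B≤f = z≤n
*-≤-sumF-but-one {suc k} {B} f P P-unique P⊎B≤f with P⊎B≤f zero
... | inj₁ P₀ = begin
  B + k * B                        ≡⟨ +-comm B (k * B) ⟩
  k * B + B                        ≤⟨ +-monoˡ-≤ B (*-≤-sumF (f ∘ suc) B≤tail) ⟩
  sumF (f ∘ suc) + B               ≤⟨ +-monoˡ-≤ B (m≤n+m (sumF (f ∘ suc)) (f zero)) ⟩
  f zero + sumF (f ∘ suc) + B      ∎
  where
  open ≤-Reasoning
  B≤tail : ∀ i → B ≤ f (suc i)
  B≤tail i with P⊎B≤f (suc i)
  ... | inj₁ Pᵢ = contradiction (P-unique zero (suc i) P₀ Pᵢ) λ ()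
  ... | inj₂ B≤fᵢ = B≤fᵢ
... | inj₂ B≤f₀ = begin
  B + k * B                        ≤⟨ +-mono-≤ B≤f₀ (*-≤-sumF-but-one (f ∘ suc) (P ∘ suc)
                                        (λ s t Pₛ Pₜ → Fin.suc-injective (P-unique (suc s) (suc t) Pₛ Pₜ))
                                        (P⊎B≤f ∘ suc)) ⟩
  f zero + (sumF (f ∘ suc) + B)    ≡⟨ +-assoc (f zero) (sumF (f ∘ suc)) B ⟨
  f zero + sumF (f ∘ suc) + B      ∎
  where open ≤-Reasoning

[d*v]%[d*m]≡d*[v%m] : ∀ d v m .{{_ : NonZero m}} .{{_ : NonZero (d * m)}} →
  (d * v) % (d * m) ≡ d * (v % m)
[d*v]%[d*m]≡d*[v%m] d v m = begin
  (d * v) % (d * m)                                ≡⟨ cong (λ z → (d * z) % (d * m)) (m≡m%n+[m/n]*n v m) ⟩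
  (d * (v % m + v / m * m)) % (d * m)              ≡⟨ cong (_% (d * m)) (regroup d (v % m) (v / m) m) ⟩
  (d * (v % m) + v / m * (d * m)) % (d * m)        ≡⟨ [m+kn]%n≡m%n (d * (v % m)) (v / m) (d * m) ⟩
  (d * (v % m)) % (d * m)                          ≡⟨ m<n⇒m%n≡m (*-monoʳ-< d (m%n<n v m)) ⟩
  d * (v % m)                                      ∎
  where
  open ≡-Reasoning
  instance _ = m*n≢0⇒m≢0 d
  regroup : ∀ d r q m → d * (r + q * m) ≡ d * r + q * (d * m)
  regroup = solve-∀

[v+k*m]%[d*m]≡v%m+[v/m+k]%d*m : ∀ v k d m .{{_ : NonZero d}} .{{_ : NonZero m}} .{{_ : NonZero (d * m)}} →
  (v + k * m) % (d * m) ≡ v % m + (v / m + k) % d * m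
[v+k*m]%[d*m]≡v%m+[v/m+k]%d*m v k d m = begin
  (v + k * m) % (d * m)                      ≡⟨ cong (λ z → (z + k * m) % (d * m)) (m≡m%n+[m/n]*n v m) ⟩
  (v % m + v / m * m + k * m) % (d * m)      ≡⟨ cong (_% (d * m)) (regroup (v % m) (v / m) k m) ⟩
  ((v / m + k) * m + v % m) % (d * m)        ≡⟨ [m*n+o]%[p*n]≡[m*n]%[p*n]+o (v / m + k) d (m%n<n v m) ⟩
  ((v / m + k) * m) % (d * m) + v % m        ≡⟨ cong (_+ v % m) (m%n*o≡m*o%[n*o] (v / m + k) d m) ⟨
  (v / m + k) % d * m + v % m                ≡⟨ +-comm _ (v % m) ⟩
  v % m + (v / m + k) % d * m                ∎
  where
  open ≡-Reasoning
  regroup : ∀ r q k m → r + q * m + k * m ≡ (q + k) * m + r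
  regroup = solve-∀

prime[7] : Prime 7
prime[7] = from-yes (prime? 7)

root-unique-≤ : ∀ {p m b s t} → Prime p → ¬ p ∣ m → s ≤ t → t < p →
  p ∣ s * m + b → p ∣ t * m + b → s ≡ t
root-unique-≤ {p} {m} {b} {s} p-prime p∤m s≤t t<p p∣sm+b p∣tm+b
  with d , refl ← m≤n⇒∃[o]m+o≡n s≤t = sym (trans (cong (s +_) d≡0) (+-identityʳ s))
  where
  p∣dm : p ∣ d * m
  p∣dm = ∣m+n∣m⇒∣n (subst (p ∣_) (regroup s d m b) p∣tm+b) p∣sm+b
    where
    regroup : ∀ s d m b → (s + d) * m + b ≡ s * m + b + d * m
    regroup = solve-∀
  d≡0 : d ≡ 0
  d≡0 with euclidsLemma d m p-prime p∣dm
  ... | inj₂ p∣m = contradiction p∣m p∤m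
  ... | inj₁ p∣d with d ≟ 0
  ...   | yes d≡0 = d≡0
  ...   | no d≢0 = contradiction (∣⇒≤ {{≢-nonZero d≢0}} p∣d) (<⇒≱ (≤-<-trans (m≤n+m d s) t<p))

root-unique : ∀ {p m b s t} → Prime p → ¬ p ∣ m → s < p → t < p →
  p ∣ s * m + b → p ∣ t * m + b → s ≡ t
root-unique {s = s} {t} p-prime p∤m s<p t<p p∣sm+b p∣tm+b with ≤-total s t
... | inj₁ s≤t = root-unique-≤ p-prime p∤m s≤t t<p p∣sm+b p∣tm+b
... | inj₂ t≤s = sym (root-unique-≤ p-prime p∤m t≤s s<p p∣tm+b p∣sm+b)

residues : ℕ → ℕ → ℕ
residues q w = sumF (λ (t : Fin 7) → (q + toℕ t * w) % 7)

residues≡21-Fin : ∀ (q w : Fin 7) → toℕ w ≢ 0 → residues (toℕ q) (toℕ w) ≡ 21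
residues≡21-Fin = from-yes (all? {7} λ q → all? {7} λ w →
  ¬? (toℕ w ≟ 0) →-dec (residues (toℕ q) (toℕ w) ≟ 21))

-- t ↦ q + t w permutes the residues mod 7, so they add up to 0 + 1 + ⋯ + 6.
residues≡21 : ∀ q w → ¬ 7 ∣ w → residues q w ≡ 21
residues≡21 q w 7∤w = begin
  residues q w                ≡⟨ sumF-cong {7} reduce ⟩
  residues (q % 7) (w % 7)    ≡⟨ subst₂ (λ a b → b ≢ 0 → residues a b ≡ 21) (toℕ-mod q) (toℕ-mod w)
                                   (residues≡21-Fin (q mod 7) (w mod 7)) (7∤w ∘ m%n≡0⇒n∣m w 7) ⟩
  21                          ∎
  where
  open ≡-Reasoning
  toℕ-mod : ∀ a → toℕ (a mod 7) ≡ a % 7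
  toℕ-mod a = toℕ-fromℕ< (m%n<n a 7)
  reduce : ∀ t → (q + toℕ t * w) % 7 ≡ (q % 7 + toℕ t * (w % 7)) % 7
  reduce t = %-cong-+ 7 {q} {q % 7} {toℕ t * w} {toℕ t * (w % 7)} (sym (m%n%n≡m%n q 7))
    (%-congʳ-* 7 (toℕ t) {w} {w % 7} (sym (m%n%n≡m%n w 7)))

11≤digit-sum : ∀ {m R K} → 5 ≤ m → R + 3 ≤ 3 * m → 2 * (7 * m) ≤ 7 + (R + K * m) → 11 ≤ K
11≤digit-sum {m} {R} {K} 5≤m R+3≤3m 14m≤S =
  ≮⇒≥ λ K<11 → <⇒≱ (+-cancelʳ-< 2 _ _ (S+2<14m+2 (<⇒≤pred K<11))) 14m≤S
  where
  open ≤-Reasoning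
  S+2<14m+2 : K ≤ 10 → 7 + (R + K * m) + 2 < 2 * (7 * m) + 2
  S+2<14m+2 K≤10 = begin
    suc (7 + (R + K * m) + 2)   ≡⟨ regroup R (K * m) ⟩
    R + 3 + (7 + K * m)         ≤⟨ +-mono-≤ R+3≤3m (+-monoʳ-≤ 7 (*-monoˡ-≤ m K≤10)) ⟩
    3 * m + (7 + 10 * m)        ≤⟨ +-monoʳ-≤ (3 * m) (+-monoˡ-≤ (10 * m) (+-monoˡ-≤ 2 5≤m)) ⟩
    3 * m + (m + 2 + 10 * m)    ≡⟨ collect m ⟩
    2 * (7 * m) + 2             ∎
    where
    regroup : ∀ R Km → suc (7 + (R + Km) + 2) ≡ R + 3 + (7 + Km)
    regroup = solve-∀
    collect : ∀ m → 3 * m + (m + 2 + 10 * m) ≡ 2 * (7 * m) + 2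
    collect = solve-∀

multiple-≢⇒2*≤ : ∀ {N s} → N ∣ s → 0 < s → s ≢ N → 2 * N ≤ s
multiple-≢⇒2*≤ (divides zero s≡0) 0<s _ = contradiction s≡0 (>⇒≢ 0<s)
multiple-≢⇒2*≤ {N} (divides (suc zero) s≡N) _ s≢N = contradiction (trans s≡N (+-identityʳ N)) s≢N
multiple-≢⇒2*≤ {N} (divides (suc (suc q)) s≡qN) _ _ =
  subst (2 * N ≤_) (sym s≡qN) (*-monoˡ-≤ N (m≤m+n 2 q))

gcd≡⇒cofactors : ∀ {n a d} .{{_ : NonZero d}} → gcd n a ≡ d →
  ∃₂ λ m y → n ≡ d * m × a ≡ d * y × gcd m y ≡ 1
gcd≡⇒cofactors {n} {a} {d} gcd≡d =
  quotient d∣n , quotient d∣a , n≡dm , a≡dy ,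
  *-cancelˡ-≡ _ 1 d (begin
    d * gcd (quotient d∣n) (quotient d∣a)        ≡⟨ c*gcd[m,n]≡gcd[cm,cn] d _ _ ⟩
    gcd (d * quotient d∣n) (d * quotient d∣a)    ≡⟨ cong₂ gcd n≡dm a≡dy ⟨
    gcd n a                                      ≡⟨ gcd≡d ⟩
    d                                            ≡⟨ *-identityʳ d ⟨
    d * 1                                        ∎)
  where
  open ≡-Reasoning
  d∣n : d ∣ n
  d∣n = subst (_∣ n) gcd≡d (gcd[m,n]∣m n a)
  d∣a : d ∣ a
  d∣a = subst (_∣ a) gcd≡d (gcd[m,n]∣n n a)
  n≡dm : n ≡ d * quotient d∣n
  n≡dm = m∣n⇒n≡m*quotient d∣n
  a≡dy : a ≡ d * quotient d∣a
  a≡dy = m∣n⇒n≡m*quotient d∣a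

gcd[7m,6]≡1⇒5≤m : ∀ m → 1 < m → gcd (7 * m) 6 ≡ 1 → 5 ≤ m
gcd[7m,6]≡1⇒5≤m 1 (s≤s ()) _
gcd[7m,6]≡1⇒5≤m 2 _ ()
gcd[7m,6]≡1⇒5≤m 3 _ ()
gcd[7m,6]≡1⇒5≤m 4 _ ()
gcd[7m,6]≡1⇒5≤m (suc (suc (suc (suc (suc _))))) _ _ = s≤s (s≤s (s≤s (s≤s (s≤s z≤n))))

n≤sum-coefficients : ∀ n .{{_ : NonZero n}} {k} (x : Fin (suc k) → ℕ) → sumF x % n ≡ 0 →
  ∀ a c → IsGen n a → Coeffs n a x c → n ≤ sumF c
n≤sum-coefficients n x Σx≡0 a c (_ , _ , gcd[a,n]≡1) coeffs =
  ∣⇒≤ {{>-nonZero (≤-trans (proj₁ (coeffs zero)) (m≤m+n (c zero) _))}} n∣Σc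
  where
  Σc*a≡0 : (sumF c * a) % n ≡ 0
  Σc*a≡0 = begin
    (sumF c * a) % n              ≡⟨ cong (_% n) (sumF-*ʳ c a) ⟨
    sumF (λ i → c i * a) % n      ≡⟨ sumF-cong-% n (λ i → proj₂ (proj₂ (coeffs i))) ⟩
    sumF x % n                    ≡⟨ Σx≡0 ⟩
    0                             ∎
    where open ≡-Reasoning
  n∣Σc : n ∣ sumF c
  n∣Σc = coprime-divisor (Coprime.sym (gcd≡1⇒coprime {a} {n} gcd[a,n]≡1))
    (subst (n ∣_) (*-comm (sumF c) a) (m%n≡0⇒n∣m _ n Σc*a≡0))

HasNormOneGenerator : (n : ℕ) → .{{_ : NonZero n}} → ∀ {k} → (Fin k → ℕ) → Set
HasNormOneGenerator n x = Σ ℕ λ a → IsGen n a × Σ (Fin _ → ℕ) λ c → Coeffs n a x c × sumF c ≡ n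

module IndexOneWitness
  (m : ℕ) (5≤m : 5 ≤ m) (7∤m : ¬ 7 ∣ m)
  (x : Fin 4 → ℕ) (7m∤x : ∀ i → ¬ 7 * m ∣ x i) (7m∣Σx : 7 * m ∣ sumF x)
  (y : ℕ) (x₀≡7y : x zero ≡ 7 * y) (y⊥m : Coprime y m)
  (7∤x : ∀ i → ¬ 7 ∣ x (suc i)) where

  open ≡-Reasoning

  1<m : 1 < m
  1<m = ≤-trans (s≤s (s≤s z≤n)) 5≤m

  1<7m : 1 < 7 * m
  1<7m = <-≤-trans 1<m (m≤m+n m (6 * m))

  instance
    m≢0 : NonZero m
    m≢0 = >-nonZero (<-trans z<s 1<m)
    7m≢0 : NonZero (7 * m)
    7m≢0 = m*n≢0 7 m

  b : ℕ
  b = proj₁ (mod-inverse m y⊥m)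

  yb≡1 : (y * b) % m ≡ 1
  yb≡1 = trans (proj₂ (mod-inverse m y⊥m)) (m<n⇒m%n≡m 1<m)

  u : Fin 7 → ℕ
  u t = toℕ t * m + b

  c : Fin 7 → Fin 4 → ℕ
  c t i = (x i * u t) % (7 * m)

  c-zero : ∀ t → c t zero ≡ 7
  c-zero t = begin
    (x zero * u t) % (7 * m)       ≡⟨ cong (λ z → (z * u t) % (7 * m)) x₀≡7y ⟩
    (7 * y * u t) % (7 * m)        ≡⟨ cong (_% (7 * m)) (*-assoc 7 y (u t)) ⟩
    (7 * (y * u t)) % (7 * m)      ≡⟨ [d*v]%[d*m]≡d*[v%m] 7 (y * u t) m ⟩
    7 * ((y * u t) % m)            ≡⟨ cong (λ z → 7 * (z % m)) (expand y (toℕ t) m b) ⟩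
    7 * ((y * b + y * toℕ t * m) % m) ≡⟨ cong (7 *_) ([m+kn]%n≡m%n (y * b) (y * toℕ t) m) ⟩
    7 * ((y * b) % m)              ≡⟨ cong (7 *_) yb≡1 ⟩
    7                              ∎
    where
    expand : ∀ y t m b → y * (t * m + b) ≡ y * b + y * t * m
    expand = solve-∀

  r : Fin 3 → ℕ
  r i = (x (suc i) * b) % m

  W : Fin 3 → Fin 7 → ℕ
  W i t = ((x (suc i) * b) / m + toℕ t * x (suc i)) % 7

  c-suc : ∀ t i → c t (suc i) ≡ r i + W i t * m
  c-suc t i = begin
    (X * u t) % (7 * m)                      ≡⟨ cong (_% (7 * m)) (expand X (toℕ t) m b) ⟩
    (X * b + toℕ t * X * m) % (7 * m)        ≡⟨ [v+k*m]%[d*m]≡v%m+[v/m+k]%d*m (X * b) (toℕ t * X) 7 m ⟩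
    r i + W i t * m                          ∎
    where
    X : ℕ
    X = x (suc i)
    expand : ∀ X t m b → X * (t * m + b) ≡ X * b + t * X * m
    expand = solve-∀

  R : ℕ
  R = sumF r

  K : Fin 7 → ℕ
  K t = sumF (λ i → W i t)

  S : Fin 7 → ℕ
  S t = sumF (c t)

  S≡7+R+Km : ∀ t → S t ≡ 7 + (R + K t * m)
  S≡7+R+Km t = begin
    c t zero + sumF (c t ∘ suc)                   ≡⟨ cong₂ _+_ (c-zero t) (sumF-cong (c-suc t)) ⟩
    7 + sumF (λ i → r i + W i t * m)              ≡⟨ cong (7 +_) (sumF-+ r (λ i → W i t * m)) ⟩
    7 + (R + sumF (λ i → W i t * m))              ≡⟨ cong (λ z → 7 + (R + z)) (sumF-*ʳ (λ i → W i t) m) ⟩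
    7 + (R + K t * m)                             ∎

  7m∣S : ∀ t → 7 * m ∣ S t
  7m∣S t = m%n≡0⇒n∣m (S t) (7 * m) (begin
    sumF (c t) % (7 * m)                      ≡⟨ sumF-cong-% (7 * m) (λ i → m%n%n≡m%n (x i * u t) (7 * m)) ⟩
    sumF (λ i → x i * u t) % (7 * m)          ≡⟨ cong (_% (7 * m)) (sumF-*ʳ x (u t)) ⟩
    (sumF x * u t) % (7 * m)                  ≡⟨ n∣m⇒m%n≡0 _ (7 * m) (∣m⇒∣m*n (u t) 7m∣Σx) ⟩
    0                                         ∎)

  11≤K : ∀ t → S t ≢ 7 * m → 11 ≤ K t
  11≤K t S≢7m = 11≤digit-sum 5≤m (sumF-<-* r (λ i → m%n<n _ m))
    (subst (2 * (7 * m) ≤_) (S≡7+R+Km t) (multiple-≢⇒2*≤ (7m∣S t) (subst (0 <_) (sym (S≡7+R+Km t)) z<s) S≢7m))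

  ΣK≡63 : sumF K ≡ 63
  ΣK≡63 = begin
    sumF (λ t → sumF (λ i → W i t))    ≡⟨ sumF-swap W ⟨
    sumF (λ i → sumF (W i))            ≡⟨ sumF-cong (λ i → residues≡21 ((x (suc i) * b) / m) (x (suc i)) (7∤x i)) ⟩
    63                                 ∎

  7∣u-unique : ∀ s t → 7 ∣ u s → 7 ∣ u t → s ≡ t
  7∣u-unique s t 7∣uₛ 7∣uₜ = toℕ-injective (root-unique prime[7] 7∤m (toℕ<n s) (toℕ<n t) 7∣uₛ 7∣uₜ)

  u⊥7m : ∀ t → ¬ 7 ∣ u t → Coprime (u t) (7 * m)
  u⊥7m t 7∤u = coprime-*ʳ (prime∤⇒coprime prime[7] 7∤u) (coprime-*+ (toℕ t) b⊥m)
    where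
    b⊥m : Coprime b m
    b⊥m = inverse⇒coprime m (trans (cong (_% m) (*-comm b y)) (proj₂ (mod-inverse m y⊥m)))

  good-multiplier : ∃ λ t → ¬ 7 ∣ u t × S t ≡ 7 * m
  good-multiplier with any? (λ t → ¬? (7 ∣? u t) ×-dec (S t ≟ 7 * m))
  ... | yes found = found
  ... | no none = contradiction 77≤74 (<⇒≱ (from-yes (74 <? 77)))
    where
    7∣u⊎11≤K : ∀ t → 7 ∣ u t ⊎ 11 ≤ K t
    7∣u⊎11≤K t with 7 ∣? u t
    ... | yes 7∣u = inj₁ 7∣u
    ... | no 7∤u = inj₂ (11≤K t λ S≡7m → none (t , 7∤u , S≡7m))
    77≤74 : 77 ≤ 74
    77≤74 = subst (λ z → 77 ≤ z + 11) ΣK≡63 (*-≤-sumF-but-one K (λ t → 7 ∣ u t) 7∣u-unique 7∣u⊎11≤K)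

  witness : HasNormOneGenerator (7 * m) x
  witness with good-multiplier
  ... | t , 7∤u , S≡7m with unit⇒coefficients (7 * m) 1<7m (u⊥7m t 7∤u) x 7m∤x
  ...   | a , a-gen , a-coeffs = a , a-gen , c t , a-coeffs , S≡7m

witness-from-cofactors : ∀ {n} .{{_ : NonZero n}} {x : Fin 4 → ℕ} →
  (∃₂ λ m y → n ≡ 7 * m × x zero ≡ 7 * y × gcd m y ≡ 1) →
  gcd n 6 ≡ 1 → (∀ i → 0 < x i × x i < n) → n ∣ sumF x → (∀ i → ¬ 7 ∣ x (suc i)) → ¬ 7 * 7 ∣ n →
  HasNormOneGenerator n x
witness-from-cofactors {x = x} (m , y , refl , x₀≡7y , gcd[m,y]≡1) gcd[7m,6]≡1 x-range 7m∣Σx 7∤x 49∤7m =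
  IndexOneWitness.witness m 5≤m (49∤7m ∘ *-monoʳ-∣ 7) x 7m∤x 7m∣Σx
    y x₀≡7y (Coprime.sym (gcd≡1⇒coprime gcd[m,y]≡1)) 7∤x
  where
  7m∤x : ∀ i → ¬ 7 * m ∣ x i
  7m∤x i = >⇒∤ {{>-nonZero (proj₁ (x-range i))}} (proj₂ (x-range i))
  1≤y : 1 ≤ y
  1≤y = n≢0⇒n>0 λ { refl → contradiction (subst (0 <_) x₀≡7y (proj₁ (x-range zero))) λ () }
  5≤m : 5 ≤ m
  5≤m = gcd[7m,6]≡1⇒5≤m m
    (≤-<-trans 1≤y (*-cancelˡ-< 7 y m (subst (_< 7 * m) x₀≡7y (proj₂ (x-range zero))))) gcd[7m,6]≡1

lemma2p5 : (n : ℕ) → .{{_ : NonZero n}} → gcd n 6 ≡ 1 → AtLeastThreePrimeFactors n →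
    (x : Fin 4 → ℕ) → (∀ i → (1 ≤ x i) × (x i ≤ n ∸ 1)) →
    gcd n (gcd (x zero) (gcd (x (suc zero)) (gcd (x (suc (suc zero))) (x (suc (suc (suc zero))))))) ≡ 1 →
    MinimalZeroSum n x →
    gcd n (x zero) ≡ 7 →
    (∀ (i : Fin 3) → gcd 7 (gcd n (x (suc i))) ≡ 1) →
    ¬ (7 * 7 ∣ n) →
    IndIsOne n x
lemma2p5 n gcd[n,6]≡1 _ x x-range _ (Σx≡0 , _) gcd[n,x₀]≡7 gcd[7,xᵢ]≡1 49∤n =
  witness-from-cofactors (gcd≡⇒cofactors gcd[n,x₀]≡7) gcd[n,6]≡1 x-bounds (m%n≡0⇒n∣m _ n Σx≡0) 7∤x 49∤n ,
  n≤sum-coefficients n x Σx≡0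
  where
  x-bounds : ∀ i → 0 < x i × x i < n
  x-bounds i = proj₁ (x-range i) ,
    m≤pred[n]⇒suc[m]≤n (subst (x i ≤_) (sym (pred[m∸n]≡m∸[1+n] n 0)) (proj₂ (x-range i)))
  7∣n : 7 ∣ n
  7∣n = subst (_∣ n) gcd[n,x₀]≡7 (gcd[m,n]∣m n (x zero))
  7∤x : ∀ i → ¬ 7 ∣ x (suc i)
  7∤x i 7∣xᵢ = contradiction
    (∣1⇒≡1 (subst (7 ∣_) (gcd[7,xᵢ]≡1 i) (gcd-greatest ∣-refl (gcd-greatest 7∣n 7∣xᵢ)))) λ ()
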